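{- Let $p$ be a prime with $p\equiv5\pmod8$ and $\{\mathcal F_n\}$ as in the context. If $\nu\ge0$ and $n$ are integers with $p^\nu\mid n$, then $p^\nu\mid\mathcal F_n$.
   Context: Let $u_p=(t+b\sqrt p)/2>1$ ($t,b$ positive integers) be the fundamental unit of $\mathbb Q(\sqrt p)$, and define $\mathcal F_0=0,\ \mathcal F_1=1,\ \mathcal F_{n+2}=t\mathcal F_{n+1}+\mathcal F_n$ for $n\in\mathbb Z$. -}

module Defs where

open import Data.Nat as ℕ using (ℕ; zero; suc)
open import Data.Integer as ℤ using (ℤ; +_; -[1+_]; _+_; _-_; _*_; _≤_; _<_; 0ℤ)
open import Data.Product using (_×_; _,_; proj₁; proj₂)
open import Data.Sum using (_⊎_)
open import Relation.Binary.PropositionalEquality using (_≡_)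

-- x ≤ y·√p  (comparison of real numbers, unfolded into integer arithmetic)
LeSqrt : ℕ → ℤ → ℤ → Set
LeSqrt p x y =
  (0ℤ ≤ y × (x ≤ 0ℤ ⊎ x * x ≤ (+ p) * y * y))
  ⊎ (y < 0ℤ × x < 0ℤ × (+ p) * y * y ≤ x * x)

-- (t + b√p)/2 is a unit of the ring of integers of Q(√p) (p ≡ 1 mod 4):
-- norm (t² - p b²)/4 = ±1.
IsUnitPair : ℕ → ℕ → ℕ → Set
IsUnitPair p t b =
  ((+ t) * (+ t) - (+ p) * (+ b) * (+ b) ≡ + 4)
  ⊎ ((+ t) * (+ t) - (+ p) * (+ b) * (+ b) ≡ ℤ.- (+ 4))

-- u_p = (t + b√p)/2 > 1 with t, b positive integers is the fundamental unit:
-- it is a unit, and it is ≤ every unit (t' + b'√p)/2 > 1 (every such unit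
-- has t', b' positive integers).
IsFundamentalUnit : ℕ → ℕ → ℕ → Set
IsFundamentalUnit p t b =
  0 ℕ.< t × 0 ℕ.< b × IsUnitPair p t b ×
  (∀ t' b' → 0 ℕ.< t' → 0 ℕ.< b' → IsUnitPair p t' b' →
     -- t + b√p ≤ t' + b'√p   ⇔   t - t' ≤ (b' - b)√p
     LeSqrt p ((+ t) - (+ t')) ((+ b') - (+ b)))

-- forward pairs (F_k, F_{k+1})
fwd : ℤ → ℕ → ℤ × ℤ
fwd t zero = 0ℤ , + 1
fwd t (suc k) with fwd t k
... | (a , b) = b , t * b + a

-- backward pairs (F_{-k}, F_{-k+1}), using F_n = F_{n+2} - t F_{n+1}
bwd : ℤ → ℕ → ℤ × ℤ
bwd t zero = 0ℤ , + 1
bwd t (suc k) with bwd t k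
... | (a , b) = b - t * a , a

-- F_0 = 0, F_1 = 1, F_{n+2} = t F_{n+1} + F_n for all n ∈ ℤ
F : ℕ → ℤ → ℤ
F t (+ n) = proj₁ (fwd (+ t) n)
F t -[1+ n ] = proj₁ (bwd (+ t) (suc n))

{-# OPTIONS --safe #-}
module Submission where

-- Let ε be a root of x² = t x + 1, so that ε^n = F_{n-1} + F_n ε in ℤ[ε].
--
-- The fundamental unit has norm -1. Otherwise t² - p b² = 4, i.e. (t - 2)(t + 2) = p b².
-- Working modulo 4 (here p ≡ 1 (mod 4) is used), either t is odd and t - 2, t + 2 are
-- coprime, or 4 ∣ t - 2 and 4 ∣ b, and (t - 2)/4, (t + 2)/4 are consecutive. In both cases
-- unique factorisation gives {t - 2, t + 2} = {r², p s²} with b = r s, and (r + s√p)/2 is a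
-- unit below u_p, contradicting minimality. Hence t² + 4 = p b².
--
-- Then δ = 2ε - t has δ² = t² + 4 ≡ 0 (mod p), and expanding (2ε)^p = (t + δ)^p modulo δ²
-- gives p ∣ 2^p F_p, so p ∣ F_p. If p ∣ D ∣ F_k, write ε^k = x + y ε with D ∣ y; expanding
-- (x + y ε)^p modulo (y ε)² gives p D ∣ F_{pk}. By induction p^ν ∣ F_{p^ν m}, and
-- F_{-k} = ±F_k takes care of negative indices.

open import Defs

module Norm where

  open import Data.Empty using (⊥-elim)
  open import Data.Integer as ℤ using (+_; 0ℤ)
  import Data.Integer.Properties as ℤ
  import Data.Integer.Tactic.RingSolver as ℤ-Solver
  open import Data.Nat.Base hiding (parity)
  open import Data.Nat.Coprimality as Coprime using (Coprime; coprime-+; coprime⇒gcd≡1; 1-coprimeTo)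
  open import Data.Nat.Divisibility
    using (_∣_; divides; ∣-antisym; ∣m+n∣m⇒∣n; ∣1⇒≡1; m∣m*n; n∣m*n; *-pres-∣; ∣m⇒∣m*n)
  open import Data.Nat.DivMod using (m≡m%n+[m/n]*n; [m+kn]%n≡m%n; m<n⇒m%n≡m)
  open import Data.Nat.GCD using (gcd; gcd[m,n]∣m; gcd[m,n]∣n; gcd-greatest; c*gcd[m,n]≡gcd[cm,cn])
  open import Data.Nat.Primality using (Prime; euclidsLemma; prime⇒nonZero)
  open import Data.Nat.Properties
  open import Data.Nat.Tactic.RingSolver
  open import Data.Product using (_×_; _,_; ∃₂)
  open import Data.Sum using (_⊎_; inj₁; inj₂; map)
  open import Function.Bundles using (_⇔_; mk⇔; Equivalence)
  open import Relation.Binary.Definitions using (tri<; tri≈; tri>)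
  open import Relation.Binary.PropositionalEquality
  open import Relation.Nullary using (¬_; contradiction)

  data Parity : ℕ → Set where
    even : ∀ k → Parity (2 * k)
    odd  : ∀ k → Parity (1 + 2 * k)

  parity : ∀ n → Parity n
  parity zero = even 0
  parity (suc n) with parity n
  ... | even k = odd k
  ... | odd k  = subst Parity (*-suc 2 k) (even (suc k))

  residue-unique : ∀ d .{{_ : NonZero d}} r₁ r₂ m n → r₁ < d → r₂ < d →
                   r₁ + m * d ≡ r₂ + n * d → r₁ ≡ r₂
  residue-unique d r₁ r₂ m n r₁<d r₂<d eq = begin
    r₁               ≡⟨ m<n⇒m%n≡m r₁<d ⟨
    r₁ % d           ≡⟨ [m+kn]%n≡m%n r₁ m d ⟨
    (r₁ + m * d) % d ≡⟨ cong (_% d) eq ⟩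
    (r₂ + n * d) % d ≡⟨ [m+kn]%n≡m%n r₂ n d ⟩
    r₂ % d           ≡⟨ m<n⇒m%n≡m r₂<d ⟩
    r₂               ∎
    where open ≡-Reasoning

  *-self-injective : ∀ m n → m * m ≡ n * n → m ≡ n
  *-self-injective m n eq with <-cmp m n
  ... | tri< m<n _ _ = ⊥-elim (<-irrefl eq (*-mono-< m<n m<n))
  ... | tri≈ _ m≡n _ = m≡n
  ... | tri> _ _ m>n = ⊥-elim (<-irrefl (sym eq) (*-mono-< m>n m>n))

  m*m<n*n⇒m<n : ∀ {m n} → m * m < n * n → m < n
  m*m<n*n⇒m<n m²<n² = ≰⇒> (λ n≤m → <⇒≱ m²<n² (*-mono-≤ n≤m n≤m))

  coprime-odd-4 : ∀ k → Coprime (1 + 2 * k) 4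
  coprime-odd-4 k {d} (d∣odd , d∣4) = ∣1⇒≡1 (∣m+n∣m⇒∣n d∣odd² (∣m⇒∣m*n (k * k + k) d∣4))
    where
    odd² : ∀ k → (1 + 2 * k) * (1 + 2 * k) ≡ 4 * (k * k + k) + 1
    odd² = solve-∀
    d∣odd² : d ∣ 4 * (k * k + k) + 1
    d∣odd² = subst (d ∣_) (odd² k) (∣m⇒∣m*n (1 + 2 * k) d∣odd)

  coprime-odd-+4 : ∀ k → Coprime (1 + 2 * k) (1 + 2 * k + 4)
  coprime-odd-+4 k = Coprime.sym (coprime-+ (Coprime.sym (coprime-odd-4 k)))

  coprime-+1 : ∀ v → Coprime v (v + 1)
  coprime-+1 v = Coprime.sym (coprime-+ (1-coprimeTo v))

  coprime-factor-of-square : ∀ {x y m} → Coprime x y → x * y ≡ m * m → gcd x m * gcd x m ≡ x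
  coprime-factor-of-square {x} {y} {m} coprime xy≡m² = ∣-antisym g²∣x x∣g²
    where
    g = gcd x m
    g∣x = gcd[m,n]∣m x m
    g∣m = gcd[m,n]∣n x m
    gcd[x²,xy]≡x : gcd (x * x) (x * y) ≡ x
    gcd[x²,xy]≡x = trans (sym (c*gcd[m,n]≡gcd[cm,cn] x x y))
                         (trans (cong (x *_) (coprime⇒gcd≡1 coprime)) (*-identityʳ x))
    g²∣x : g * g ∣ x
    g²∣x = subst (g * g ∣_) gcd[x²,xy]≡x
             (gcd-greatest (*-pres-∣ g∣x g∣x) (subst (g * g ∣_) (sym xy≡m²) (*-pres-∣ g∣m g∣m)))
    x∣gc : ∀ c → x ∣ c * x → x ∣ c * m → x ∣ g * c
    x∣gc c x∣cx x∣cm =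
      subst (x ∣_) (trans (sym (c*gcd[m,n]≡gcd[cm,cn] c x m)) (*-comm c g)) (gcd-greatest x∣cx x∣cm)
    x∣g² : x ∣ g * g
    x∣g² = subst (x ∣_) (sym (c*gcd[m,n]≡gcd[cm,cn] g x m))
             (gcd-greatest (x∣gc x (m∣m*n x) (m∣m*n m))
                           (x∣gc m (n∣m*n m) (subst (x ∣_) xy≡m² (m∣m*n y))))

  record SquareSplit (p a c z : ℕ) : Set where
    constructor split
    field
      r s     : ℕ
      z≡rs    : z ≡ r * s
      factors : (a ≡ r * r × c ≡ p * (s * s)) ⊎ (a ≡ p * (s * s) × c ≡ r * r)

  SquareSplit-swap : ∀ {p a c z} → SquareSplit p c a z → SquareSplit p a c z
  SquareSplit-swap (split r s z≡rs (inj₁ (c≡r² , a≡ps²))) = split r s z≡rs (inj₂ (a≡ps² , c≡r²))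
  SquareSplit-swap (split r s z≡rs (inj₂ (c≡ps² , a≡r²))) = split r s z≡rs (inj₁ (a≡r² , c≡ps²))

  p∣a⇒SquareSplit : ∀ {p a c z} → Prime p → p ∣ a → Coprime a c → a * c ≡ p * (z * z) →
                    SquareSplit p a c z
  p∣a⇒SquareSplit {p} {c = c} {z} p-prime (divides a′ refl) coprime a′pc≡pz² =
    split r s z≡rs (inj₂ (trans (*-comm a′ p) (cong (p *_) (sym s²≡a′)) , sym r²≡c))
    where
    instance _ = prime⇒nonZero p-prime
    reorder : ∀ p a′ c → p * (a′ * c) ≡ a′ * p * c
    reorder = solve-∀
    a′c≡z² : a′ * c ≡ z * z
    a′c≡z² = *-cancelˡ-≡ (a′ * c) (z * z) p (trans (reorder p a′ c) a′pc≡pz²)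
    coprime′ : Coprime a′ c
    coprime′ (d∣a′ , d∣c) = coprime (∣m⇒∣m*n p d∣a′ , d∣c)
    s = gcd a′ z
    r = gcd c z
    s²≡a′ : s * s ≡ a′
    s²≡a′ = coprime-factor-of-square coprime′ a′c≡z²
    r²≡c : r * r ≡ c
    r²≡c = coprime-factor-of-square (Coprime.sym coprime′) (trans (*-comm c a′) a′c≡z²)
    regroup : ∀ s r → s * s * (r * r) ≡ r * s * (r * s)
    regroup = solve-∀
    z≡rs : z ≡ r * s
    z≡rs = *-self-injective z (r * s)
             (trans (sym a′c≡z²) (trans (cong₂ _*_ (sym s²≡a′) (sym r²≡c)) (regroup s r)))

  coprime⇒SquareSplit : ∀ {p a c z} → Prime p → Coprime a c → a * c ≡ p * (z * z) → SquareSplit p a c z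
  coprime⇒SquareSplit {p} {a} {c} {z} p-prime coprime ac≡pz²
    with euclidsLemma a c p-prime (divides (z * z) (trans ac≡pz² (*-comm p (z * z))))
  ... | inj₁ p∣a = p∣a⇒SquareSplit p-prime p∣a coprime ac≡pz²
  ... | inj₂ p∣c = SquareSplit-swap
                     (p∣a⇒SquareSplit p-prime p∣c (Coprime.sym coprime) (trans (*-comm c a) ac≡pz²))

  private
    even*[even+4] : ∀ w → 2 * w * (2 * w + 4) ≡ 0 + w * (w + 2) * 4
    even*[even+4] = solve-∀

    even*[even+2] : ∀ v → 2 * v * (2 * v + 2) ≡ 0 + v * (v + 1) * 4
    even*[even+2] = solve-∀

    odd*[odd+2] : ∀ v → (1 + 2 * v) * (1 + 2 * v + 2) ≡ 3 + (v * v + 2 * v) * 4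
    odd*[odd+2] = solve-∀

    4*[r*s] : ∀ r s → 2 * (2 * (r * s)) ≡ 2 * r * (2 * s)
    4*[r*s] = solve-∀

    4*[p*s²] : ∀ p s → 2 * (2 * (p * (s * s))) ≡ p * (2 * s * (2 * s))
    4*[p*s²] = solve-∀

    4*v+4 : ∀ v → 2 * (2 * v) + 4 ≡ 2 * (2 * (v + 1))
    4*v+4 = solve-∀

  module _ {p} (p-prime : Prime p) (p≡1[4] : p % 4 ≡ 1) where

    private
      q = p / 4

      p≡1+4q : p ≡ 1 + q * 4
      p≡1+4q = trans (m≡m%n+[m/n]*n p 4) (cong (_+ q * 4) p≡1[4])

      p*odd² : ∀ u → p * ((1 + 2 * u) * (1 + 2 * u)) ≡ 1 + (q + p * (u * u + u)) * 4
      p*odd² u = trans (cong (λ p → p * ((1 + 2 * u) * (1 + 2 * u))) p≡1+4q)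
                       (trans (expand q u) (cong (λ p → 1 + (q + p * (u * u + u)) * 4) (sym p≡1+4q)))
        where
        expand : ∀ q u → (1 + q * 4) * ((1 + 2 * u) * (1 + 2 * u))
                         ≡ 1 + (q + (1 + q * 4) * (u * u + u)) * 4
        expand = solve-∀

      p*even² : ∀ u → p * (2 * u * (2 * u)) ≡ 0 + p * (u * u) * 4
      p*even² u = expand p u
        where
        expand : ∀ p u → p * (2 * u * (2 * u)) ≡ 0 + p * (u * u) * 4
        expand = solve-∀

      4*-SquareSplit : ∀ {v u} → SquareSplit p v (v + 1) u →
                       SquareSplit p (2 * (2 * v)) (2 * (2 * v) + 4) (2 * (2 * u))
      4*-SquareSplit (split r s refl (inj₁ (refl , r²+1≡ps²))) =
        split (2 * r) (2 * s) (4*[r*s] r s)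
          (inj₁ (4*[r*s] r r ,
                 trans (4*v+4 (r * r)) (trans (cong (λ x → 2 * (2 * x)) r²+1≡ps²) (4*[p*s²] p s))))
      4*-SquareSplit (split r s refl (inj₂ (refl , ps²+1≡r²))) =
        split (2 * r) (2 * s) (4*[r*s] r s)
          (inj₂ (4*[p*s²] p s ,
                 trans (4*v+4 (p * (s * s))) (trans (cong (λ x → 2 * (2 * x)) ps²+1≡r²) (4*[r*s] r r))))

      -- Unless 2 ∣ w and 2 ∣ y, the two sides differ modulo 4, as p ≡ 1 (mod 4).
      descent-even : ∀ w y → w * (w + 2) ≡ p * (y * y) → SquareSplit p (2 * w) (2 * w + 4) (2 * y)
      descent-even w y eq with parity w | parity y
      ... | odd v  | even u
            with residue-unique 4 3 0 (v * v + 2 * v) (p * (u * u)) (n<1+n 3) z<s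
                   (trans (sym (odd*[odd+2] v)) (trans eq (p*even² u)))
      ...   | ()
      descent-even w y eq | odd v  | odd u
            with residue-unique 4 3 1 (v * v + 2 * v) (q + p * (u * u + u)) (n<1+n 3) (s<s z<s)
                   (trans (sym (odd*[odd+2] v)) (trans eq (p*odd² u)))
      ...   | ()
      descent-even w y eq | even v | odd u
            with residue-unique 4 0 1 (v * (v + 1)) (q + p * (u * u + u)) z<s (s<s z<s)
                   (trans (sym (even*[even+2] v)) (trans eq (p*odd² u)))
      ...   | ()
      descent-even w y eq | even v | even u =
        4*-SquareSplit {v} {u} (coprime⇒SquareSplit p-prime (coprime-+1 v)
          (*-cancelʳ-≡ (v * (v + 1)) (p * (u * u)) 4
            (trans (sym (even*[even+2] v)) (trans eq (p*even² u)))))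

    descent : ∀ a b → a * (a + 4) ≡ p * (b * b) → SquareSplit p a (a + 4) b
    descent a b eq with parity a | parity b
    ... | odd k  | _     = coprime⇒SquareSplit p-prime (coprime-odd-+4 k) eq
    ... | even w | odd y
          with residue-unique 4 0 1 (w * (w + 2)) (q + p * (y * y + y)) z<s (s<s z<s)
                 (trans (sym (even*[even+4] w)) (trans eq (p*odd² y)))
    ...   | ()
    descent a b eq | even w | even y = descent-even w y
      (*-cancelʳ-≡ (w * (w + 2)) (p * (y * y)) 4 (trans (sym (even*[even+4] w)) (trans eq (p*even² y))))

  Norm≡±4 : ℕ → ℕ → ℕ → Set
  Norm≡±4 p r s = r * r ≡ 4 + p * (s * s) ⊎ r * r + 4 ≡ p * (s * s)

  IsUnitPair⇔Norm≡±4 : ∀ {p r s} → IsUnitPair p r s ⇔ Norm≡±4 p r s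
  IsUnitPair⇔Norm≡±4 {p} {r} {s} = mk⇔
    (map (λ eq → +m-+n≡+k⇒m≡k+n (trans (sym norm-ℕ) eq)) (λ eq → +m-+n≡-k⇒m+k≡n (trans (sym norm-ℕ) eq)))
    (map (λ eq → trans norm-ℕ (m≡k+n⇒+m-+n≡+k eq)) (λ eq → trans norm-ℕ (m+k≡n⇒+m-+n≡-k eq)))
    where
    norm-ℕ : + r ℤ.* + r ℤ.- + p ℤ.* + s ℤ.* + s ≡ + (r * r) ℤ.- + (p * (s * s))
    norm-ℕ = cong₂ ℤ._-_ (sym (ℤ.pos-* r r))
      (trans (cong (ℤ._* + s) (sym (ℤ.pos-* p s)))
             (trans (sym (ℤ.pos-* (p * s) s)) (cong +_ (*-assoc p s s))))
    m-n+n : ∀ m n → m ≡ m ℤ.- n ℤ.+ n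
    m-n+n = ℤ-Solver.solve-∀
    +m-+n≡+k⇒m≡k+n : ∀ {m n k} → + m ℤ.- + n ≡ + k → m ≡ k + n
    +m-+n≡+k⇒m≡k+n {m} {n} eq = ℤ.+-injective (trans (m-n+n (+ m) (+ n)) (cong (ℤ._+ + n) eq))
    m≡k+n⇒+m-+n≡+k : ∀ {m n k} → m ≡ k + n → + m ℤ.- + n ≡ + k
    m≡k+n⇒+m-+n≡+k {n = n} {k} refl = cancel (+ k) (+ n)
      where
      cancel : ∀ k n → k ℤ.+ n ℤ.- n ≡ k
      cancel = ℤ-Solver.solve-∀
    +m-+n≡-k⇒m+k≡n : ∀ {m n k} → + m ℤ.- + n ≡ ℤ.- + k → m + k ≡ n
    +m-+n≡-k⇒m+k≡n {m} {n} {k} eq = ℤ.+-injective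
      (trans (cong (ℤ._+ + k) (trans (m-n+n (+ m) (+ n)) (cong (ℤ._+ + n) eq))) (cancel (+ n) (+ k)))
      where
      cancel : ∀ n k → ℤ.- k ℤ.+ n ℤ.+ k ≡ n
      cancel = ℤ-Solver.solve-∀
    m+k≡n⇒+m-+n≡-k : ∀ {m n k} → m + k ≡ n → + m ℤ.- + n ≡ ℤ.- + k
    m+k≡n⇒+m-+n≡-k {m} {k = k} refl = cancel (+ m) (+ k)
      where
      cancel : ∀ m k → m ℤ.- (m ℤ.+ k) ≡ ℤ.- k
      cancel = ℤ-Solver.solve-∀

  ¬LeSqrt[pos,nonpos] : ∀ {p x y} → 0ℤ ℤ.< x → y ℤ.≤ 0ℤ → ¬ LeSqrt p x y
  ¬LeSqrt[pos,nonpos] 0<x y≤0 (inj₁ (0≤y , inj₁ x≤0)) = ℤ.<⇒≱ 0<x x≤0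
  ¬LeSqrt[pos,nonpos] {p} {x} 0<x y≤0 (inj₁ (0≤y , inj₂ x²≤py²)) = ℤ.<⇒≱ 0<x² x²≤0
    where
    0<x² : 0ℤ ℤ.< x ℤ.* x
    0<x² = subst (ℤ._< x ℤ.* x) (ℤ.*-zeroʳ x) (ℤ.*-monoˡ-<-pos x {{ℤ.positive 0<x}} 0<x)
    x²≤0 : x ℤ.* x ℤ.≤ 0ℤ
    x²≤0 = subst (x ℤ.* x ℤ.≤_) (ℤ.*-zeroʳ (+ p ℤ.* 0ℤ))
             (subst (λ y → x ℤ.* x ℤ.≤ + p ℤ.* y ℤ.* y) (ℤ.≤-antisym y≤0 0≤y) x²≤py²)
  ¬LeSqrt[pos,nonpos] 0<x y≤0 (inj₂ (_ , x<0 , _)) = ℤ.<-asym 0<x x<0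

  fundamental⇒no-smaller-unit : ∀ {p t b r s} → IsFundamentalUnit p t b →
                                0 < r → 0 < s → r < t → s ≤ b → ¬ IsUnitPair p r s
  fundamental⇒no-smaller-unit {p} {t} {b} {r} {s} (_ , _ , _ , minimal) 0<r 0<s r<t s≤b unit =
    ¬LeSqrt[pos,nonpos] {p} 0<t-r (ℤ.i≤j⇒i-j≤0 (ℤ.+≤+ s≤b)) (minimal r s 0<r 0<s unit)
    where
    0<t-r : 0ℤ ℤ.< + t ℤ.- + r
    0<t-r = subst (0ℤ ℤ.<_) (sym (trans (ℤ.[+m]-[+n]≡m⊖n t r) (ℤ.⊖-≥ (<⇒≤ r<t))))
                  (ℤ.+<+ (m<n⇒0<n∸m r<t))

  [2+a]²≡4+a[a+4] : ∀ a → (2 + a) * (2 + a) ≡ 4 + a * (a + 4)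
  [2+a]²≡4+a[a+4] = solve-∀

  module _ {p} (p-prime : Prime p) (p≡1[4] : p % 4 ≡ 1) where

    smaller-unit : ∀ a {b} → 0 < b → a * (a + 4) ≡ p * (b * b) →
                   ∃₂ λ r s → 0 < r × 0 < s × r < 2 + a × s ≤ b × Norm≡±4 p r s
    smaller-unit a {b} 0<b eq with descent p-prime p≡1[4] a b eq
    ... | split r s refl factors =
      r , s , >-nonZero⁻¹ r , >-nonZero⁻¹ s , r<2+a , m≤n*m s r , norm factors
      where
      instance
        rs≢0 : NonZero (r * s)
        rs≢0 = >-nonZero 0<b
        r≢0 : NonZero r
        r≢0 = m*n≢0⇒m≢0 r
        s≢0 : NonZero s
        s≢0 = m*n≢0⇒n≢0 r
        a≢0 : NonZero a
        a≢0 = m*n≢0⇒m≢0 a {{subst NonZero (sym eq)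
                (m*n≢0 p (r * s * (r * s)) {{prime⇒nonZero p-prime}} {{m*n≢0 (r * s) (r * s)}})}}
      a+4<[2+a]² : a + 4 < (2 + a) * (2 + a)
      a+4<[2+a]² = subst₂ _<_ (+-comm 4 a) (sym ([2+a]²≡4+a[a+4] a))
                     (+-monoʳ-< 4 (m<m*n a (a + 4) (≤-trans (s≤s (s≤s z≤n)) (m≤n+m 4 a))))
      r²≤a+4 : _ → r * r ≤ a + 4
      r²≤a+4 (inj₁ (a≡r² , _))   = ≤-trans (≤-reflexive (sym a≡r²)) (m≤m+n a 4)
      r²≤a+4 (inj₂ (_ , a+4≡r²)) = ≤-reflexive (sym a+4≡r²)
      r<2+a : r < 2 + a
      r<2+a = m*m<n*n⇒m<n (≤-<-trans (r²≤a+4 factors) a+4<[2+a]²)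
      norm : _ → Norm≡±4 p r s
      norm (inj₁ (a≡r² , a+4≡ps²)) = inj₂ (subst (λ a → a + 4 ≡ p * (s * s)) a≡r² a+4≡ps²)
      norm (inj₂ (a≡ps² , a+4≡r²)) = inj₁ (trans (sym a+4≡r²) (trans (+-comm a 4) (cong (_+_ 4) a≡ps²)))

    fundamental-norm≢4 : ∀ {t b} → IsFundamentalUnit p t b → t * t ≢ 4 + p * (b * b)
    fundamental-norm≢4 {zero} _ ()
    fundamental-norm≢4 {suc zero} _ ()
    fundamental-norm≢4 {suc (suc a)} {b} fu@(_ , 0<b , _) eq
      with smaller-unit a 0<b (+-cancelˡ-≡ 4 _ _ (trans (sym ([2+a]²≡4+a[a+4] a)) eq))
    ... | r , s , 0<r , 0<s , r<t , s≤b , norm =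
      fundamental⇒no-smaller-unit {p} fu 0<r 0<s r<t s≤b
        (Equivalence.from (IsUnitPair⇔Norm≡±4 {p} {r} {s}) norm)

    fundamental-unit-norm : ∀ {t b} → IsFundamentalUnit p t b → t * t + 4 ≡ p * (b * b)
    fundamental-unit-norm {t} {b} fu@(_ , _ , unit , _)
      with Equivalence.to (IsUnitPair⇔Norm≡±4 {p} {t} {b}) unit
    ... | inj₁ norm≡4  = contradiction norm≡4 (fundamental-norm≢4 fu)
    ... | inj₂ norm≡-4 = norm≡-4

module Lucas where

  open import Algebra.Bundles using (CommutativeMonoid)
  open import Data.Empty using (⊥-elim)
  open import Data.Integer as ℤ using (ℤ; +_; _+_; _*_; _-_; -_; 0ℤ; 1ℤ; -1ℤ)
  import Data.Integer.Properties as ℤ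
  open import Data.Integer.Divisibility.Signed
  open import Data.Integer.Tactic.RingSolver
  open import Data.List using (_∷_; [])
  open import Data.Nat as ℕ using (ℕ; zero; suc)
  import Data.Nat.Divisibility as ℕ
  import Data.Nat.Properties as ℕ
  open import Data.Nat.Primality using (Prime; euclidsLemma)
  open import Data.Product using (_×_; _,_; proj₁; proj₂; ∃-syntax)
  open import Data.Sum using (inj₁; inj₂)
  open import Level using (0ℓ)
  open import Relation.Binary.PropositionalEquality

  *-pres-∣ : ∀ {a b m n} → a ∣ m → b ∣ n → a * b ∣ m * n
  *-pres-∣ {b = b} {m} a∣m b∣n = ∣-trans (*-monoˡ-∣ b a∣m) (*-monoʳ-∣ m b∣n)

  module _ {p} (p-prime : Prime p) (2<p : 2 ℕ.< p) where

    ∣2*⇒∣ : ∀ x → + p ∣ + 2 * x → + p ∣ x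
    ∣2*⇒∣ x p∣2x with euclidsLemma 2 ℤ.∣ x ∣ p-prime (subst (p ℕ.∣_) (ℤ.abs-* (+ 2) x) (∣⇒∣ᵤ p∣2x))
    ... | inj₁ p∣2 = ⊥-elim (ℕ.<⇒≱ 2<p (ℕ.∣⇒≤ p∣2))
    ... | inj₂ p∣x = ∣ᵤ⇒∣ p∣x

    ∣2^n*⇒∣ : ∀ n x → + p ∣ (+ 2) ℤ.^ n * x → + p ∣ x
    ∣2^n*⇒∣ zero x p∣x = subst (+ p ∣_) (ℤ.*-identityˡ x) p∣x
    ∣2^n*⇒∣ (suc n) x p∣2^[1+n]x =
      ∣2^n*⇒∣ n x (∣2*⇒∣ _ (subst (+ p ∣_) (ℤ.*-assoc (+ 2) ((+ 2) ℤ.^ n) x) p∣2^[1+n]x))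

  module QuadraticOrder (t : ℤ) where

    infixl 7 _·_
    infixr 8 _^_
    infix 4 _∣ᶜ_

    -- (x , y) stands for x + y ε, where ε² = t ε + 1.
    _·_ : ℤ × ℤ → ℤ × ℤ → ℤ × ℤ
    (x₁ , y₁) · (x₂ , y₂) = x₁ * x₂ + y₁ * y₂ , x₁ * y₂ + y₁ * x₂ + t * y₁ * y₂

    1# : ℤ × ℤ
    1# = 1ℤ , 0ℤ

    ε : ℤ × ℤ
    ε = 0ℤ , 1ℤ

    ·-assoc : ∀ z w v → (z · w) · v ≡ z · (w · v)
    ·-assoc (a , b) (c , d) (e , f) = cong₂ _,_ (assoc₁ t a b c d e f) (assoc₂ t a b c d e f)
      where
      assoc₁ : ∀ t a b c d e f → (a * c + b * d) * e + (a * d + b * c + t * b * d) * f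
                                ≡ a * (c * e + d * f) + b * (c * f + d * e + t * d * f)
      assoc₁ = solve-∀
      assoc₂ : ∀ t a b c d e f →
               (a * c + b * d) * f + (a * d + b * c + t * b * d) * e + t * (a * d + b * c + t * b * d) * f
               ≡ a * (c * f + d * e + t * d * f) + b * (c * e + d * f) + t * b * (c * f + d * e + t * d * f)
      assoc₂ = solve-∀

    ·-comm : ∀ z w → z · w ≡ w · z
    ·-comm (a , b) (c , d) = cong₂ _,_ (solve (a ∷ b ∷ c ∷ d ∷ [])) (solve (t ∷ a ∷ b ∷ c ∷ d ∷ []))

    ·-identityˡ : ∀ z → 1# · z ≡ z
    ·-identityˡ (a , b) = cong₂ _,_ (solve (a ∷ b ∷ [])) (solve (t ∷ a ∷ b ∷ []))

    ·-1-commutativeMonoid : CommutativeMonoid 0ℓ 0ℓ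
    ·-1-commutativeMonoid = record
      { Carrier             = ℤ × ℤ
      ; _≈_                 = _≡_
      ; _∙_                 = _·_
      ; ε                   = 1#
      ; isCommutativeMonoid = record
        { isMonoid = record
          { isSemigroup = record { isMagma = isMagma _·_ ; assoc = ·-assoc }
          ; identity    = ·-identityˡ , λ z → trans (·-comm z 1#) (·-identityˡ z)
          }
        ; comm     = ·-comm
        }
      }

    open import Algebra.Properties.CommutativeMonoid.Mult ·-1-commutativeMonoid
      using (×-assocˡ; ×-distrib-+) renaming (_×_ to _×ᵐ_)

    _^_ : ℤ × ℤ → ℕ → ℤ × ℤ
    z ^ n = n ×ᵐ z

    scalar-· : ∀ k x y → (k , 0ℤ) · (x , y) ≡ (k * x , k * y)
    scalar-· k x y = cong₂ _,_ (solve (k ∷ x ∷ y ∷ [])) (solve (t ∷ k ∷ x ∷ y ∷ []))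

    ^-scalar : ∀ c n → (c , 0ℤ) ^ n ≡ (c ℤ.^ n , 0ℤ)
    ^-scalar c zero    = refl
    ^-scalar c (suc n) = begin
      (c , 0ℤ) · (c , 0ℤ) ^ n   ≡⟨ cong ((c , 0ℤ) ·_) (^-scalar c n) ⟩
      (c , 0ℤ) · (c ℤ.^ n , 0ℤ) ≡⟨ scalar-· c (c ℤ.^ n) 0ℤ ⟩
      (c ℤ.^ suc n , c * 0ℤ)    ≡⟨ cong (c ℤ.^ suc n ,_) (ℤ.*-zeroʳ c) ⟩
      (c ℤ.^ suc n , 0ℤ)        ∎
      where open ≡-Reasoning

    fib : ℕ → ℤ
    fib n = proj₁ (fwd t n)

    ε-^ : ∀ n → ε ^ n ≡ (proj₂ (fwd t n) - t * fib n , fib n)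
    ε-^ zero    = cong₂ _,_ (solve (t ∷ [])) refl
    ε-^ (suc n) = trans (cong (ε ·_) (ε-^ n)) (ε-step (fib n) (proj₂ (fwd t n)))
      where
      ε-step : ∀ a b → ε · (b - t * a , a) ≡ (t * b + a - t * b , b)
      ε-step a b = cong₂ _,_ (solve (t ∷ a ∷ b ∷ [])) (solve (t ∷ a ∷ b ∷ []))

    proj₂-ε^ : ∀ n → proj₂ (ε ^ n) ≡ fib n
    proj₂-ε^ n = cong proj₂ (ε-^ n)

    proj₂-[2ε]^ : ∀ n → proj₂ ((0ℤ , + 2) ^ n) ≡ (+ 2) ℤ.^ n * fib n
    proj₂-[2ε]^ n = begin
      proj₂ ((0ℤ , + 2) ^ n)                   ≡⟨ cong (λ z → proj₂ (z ^ n)) 2ε≡2·ε ⟩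
      proj₂ (((+ 2 , 0ℤ) · ε) ^ n)             ≡⟨ cong proj₂ (×-distrib-+ (+ 2 , 0ℤ) ε n) ⟩
      proj₂ ((+ 2 , 0ℤ) ^ n · ε ^ n)           ≡⟨ cong₂ (λ a z → proj₂ (a · z)) (^-scalar (+ 2) n) (ε-^ n) ⟩
      proj₂ (((+ 2) ℤ.^ n , 0ℤ) · (x , fib n)) ≡⟨ cong proj₂ (scalar-· ((+ 2) ℤ.^ n) x (fib n)) ⟩
      (+ 2) ℤ.^ n * fib n                      ∎
      where
      open ≡-Reasoning
      x = proj₂ (fwd t n) - t * fib n
      2ε≡2·ε : (0ℤ , + 2) ≡ (+ 2 , 0ℤ) · ε
      2ε≡2·ε = cong₂ _,_ refl (solve (t ∷ []))

    bwd≡±fib : ∀ k → bwd t k ≡ (-1ℤ ℤ.^ suc k * fib k , -1ℤ ℤ.^ k * (proj₂ (fwd t k) - t * fib k))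
    bwd≡±fib zero    = cong₂ _,_ refl (solve (t ∷ []))
    bwd≡±fib (suc k) =
      trans (cong (λ w → proj₂ w - t * proj₁ w , proj₁ w) (bwd≡±fib k))
            (bwd-step (-1ℤ ℤ.^ k) (fib k) (proj₂ (fwd t k)))
      where
      bwd-step : ∀ σ a b → (σ * (b - t * a) - t * (-1ℤ * σ * a) , -1ℤ * σ * a)
                           ≡ (-1ℤ * (-1ℤ * σ) * b , -1ℤ * σ * (t * b + a - t * b))
      bwd-step σ a b = cong₂ _,_ (solve (σ ∷ t ∷ a ∷ b ∷ [])) (solve (σ ∷ t ∷ a ∷ b ∷ []))

    ∣fib⇒∣fib-neg : ∀ {d} k → d ∣ fib k → d ∣ proj₁ (bwd t k)
    ∣fib⇒∣fib-neg {d} k d∣F[k] =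
      subst (d ∣_) (sym (cong proj₁ (bwd≡±fib k))) (∣n⇒∣m*n (-1ℤ ℤ.^ suc k) d∣F[k])

    ∣proj₂-· : ∀ {d} z w → d ∣ proj₂ z → d ∣ proj₂ w → d ∣ proj₂ (z · w)
    ∣proj₂-· (x₁ , y₁) (x₂ , y₂) d∣y₁ d∣y₂ =
      ∣m∣n⇒∣m+n (∣m∣n⇒∣m+n (∣n⇒∣m*n x₁ d∣y₂) (∣m⇒∣m*n x₂ d∣y₁)) (∣n⇒∣m*n (t * y₁) d∣y₂)

    ∣proj₂-^ : ∀ {d} z → d ∣ proj₂ z → ∀ n → d ∣ proj₂ (z ^ n)
    ∣proj₂-^ z d∣y zero    = divides 0ℤ refl
    ∣proj₂-^ z d∣y (suc n) = ∣proj₂-· z (z ^ n) d∣y (∣proj₂-^ z d∣y n)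

    ∣fib⇒∣fib-* : ∀ {d} k → d ∣ fib k → ∀ m → d ∣ fib (m ℕ.* k)
    ∣fib⇒∣fib-* {d} k d∣F[k] m = subst (d ∣_) (begin
      proj₂ ((ε ^ k) ^ m)   ≡⟨ cong proj₂ (×-assocˡ ε m k) ⟩
      proj₂ (ε ^ (m ℕ.* k)) ≡⟨ proj₂-ε^ (m ℕ.* k) ⟩
      fib (m ℕ.* k)         ∎)
      (∣proj₂-^ (ε ^ k) (subst (d ∣_) (sym (proj₂-ε^ k)) d∣F[k]) m)
      where open ≡-Reasoning

    _∣ᶜ_ : ℤ → ℤ × ℤ → Set
    d ∣ᶜ z = d ∣ proj₁ z × d ∣ proj₂ z

    ∣ᶜ-·ʳ : ∀ {d} z w → d ∣ᶜ w → d ∣ᶜ z · w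
    ∣ᶜ-·ʳ (a , b) (x , y) (d∣x , d∣y) =
      ∣m∣n⇒∣m+n (∣n⇒∣m*n a d∣x) (∣n⇒∣m*n b d∣y) ,
      ∣m∣n⇒∣m+n (∣m∣n⇒∣m+n (∣n⇒∣m*n a d∣y) (∣n⇒∣m*n b d∣x)) (∣n⇒∣m*n (t * b) d∣y)

    binomial-mod : ∀ {I} c u₁ u₂ → I ∣ᶜ (u₁ , u₂) · (u₁ , u₂) → ∀ m →
                   ∃[ e ] I ∣ᶜ e × (c + u₁ , u₂) ^ suc m ≡
                     (c ℤ.^ suc m + + suc m * c ℤ.^ m * u₁ + proj₁ e , + suc m * c ℤ.^ m * u₂ + proj₂ e)
    binomial-mod c u₁ u₂ I∣u² zero =
      (0ℤ , 0ℤ) , (divides 0ℤ refl , divides 0ℤ refl) , cong₂ _,_ (base₁ c u₁ u₂) (base₂ t c u₁ u₂)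
      where
      base₁ : ∀ c u₁ u₂ → (c + u₁) * 1ℤ + u₂ * 0ℤ ≡ c * 1ℤ + + 1 * 1ℤ * u₁ + 0ℤ
      base₁ = solve-∀
      base₂ : ∀ t c u₁ u₂ → (c + u₁) * 0ℤ + u₂ * 1ℤ + t * u₂ * 0ℤ ≡ + 1 * 1ℤ * u₂ + 0ℤ
      base₂ = solve-∀
    binomial-mod {I} c u₁ u₂ I∣u² (suc m) with binomial-mod c u₁ u₂ I∣u² m
    ... | e , I∣e , eq = e′ , I∣e′ , trans (cong (z ·_) eq) (cong₂ _,_
            (step₁ c (c ℤ.^ m) (+ suc m) u₁ u₂ (proj₁ e) (proj₂ e))
            (step₂ t c (c ℤ.^ m) (+ suc m) u₁ u₂ (proj₁ e) (proj₂ e)))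
      where
      z = (c + u₁ , u₂)
      B = + suc m * c ℤ.^ m
      u² = (u₁ , u₂) · (u₁ , u₂)
      e′ = (B * proj₁ u² + proj₁ (z · e) , B * proj₂ u² + proj₂ (z · e))
      I∣e′ : I ∣ᶜ e′
      I∣e′ = ∣m∣n⇒∣m+n (∣n⇒∣m*n B (proj₁ I∣u²)) (proj₁ (∣ᶜ-·ʳ z e I∣e)) ,
             ∣m∣n⇒∣m+n (∣n⇒∣m*n B (proj₂ I∣u²)) (proj₂ (∣ᶜ-·ʳ z e I∣e))
      step₁ : ∀ c P M u₁ u₂ e₁ e₂ →
        let x = c * P + M * P * u₁ + e₁ ; y = M * P * u₂ + e₂ in
        (c + u₁) * x + u₂ * y
          ≡ c * (c * P) + (+ 1 + M) * (c * P) * u₁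
            + (M * P * (u₁ * u₁ + u₂ * u₂) + ((c + u₁) * e₁ + u₂ * e₂))
      step₁ = solve-∀
      step₂ : ∀ t c P M u₁ u₂ e₁ e₂ →
        let x = c * P + M * P * u₁ + e₁ ; y = M * P * u₂ + e₂ in
        (c + u₁) * y + u₂ * x + t * u₂ * y
          ≡ (+ 1 + M) * (c * P) * u₂
            + (M * P * (u₁ * u₂ + u₂ * u₁ + t * u₂ * u₂) + ((c + u₁) * e₂ + u₂ * e₁ + t * u₂ * e₂))
      step₂ = solve-∀

    -- (- t , + 2) is δ = 2ε - t.
    δ²≡disc : (- t , + 2) · (- t , + 2) ≡ (t * t + + 4 , 0ℤ)
    δ²≡disc = cong₂ _,_ (solve (t ∷ [])) (solve (t ∷ []))

    ∣disc⇒∣fib : ∀ {p} → Prime p → 2 ℕ.< p → + p ∣ t * t + + 4 → + p ∣ fib p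
    ∣disc⇒∣fib {suc p′} p-prime 2<p p∣disc
      with binomial-mod t (- t) (+ 2) (subst (+ suc p′ ∣ᶜ_) (sym δ²≡disc) (p∣disc , divides 0ℤ refl)) p′
    ... | e , p∣e , eq = ∣2^n*⇒∣ p-prime 2<p (suc p′) (fib (suc p′)) (subst (+ suc p′ ∣_) expand p∣expand)
      where
      open ≡-Reasoning
      expand : + suc p′ * t ℤ.^ p′ * + 2 + proj₂ e ≡ (+ 2) ℤ.^ suc p′ * fib (suc p′)
      expand = begin
        + suc p′ * t ℤ.^ p′ * + 2 + proj₂ e ≡⟨ cong proj₂ eq ⟨
        proj₂ ((t + - t , + 2) ^ suc p′)    ≡⟨ cong (λ x → proj₂ ((x , + 2) ^ suc p′)) (ℤ.+-inverseʳ t) ⟩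
        proj₂ ((0ℤ , + 2) ^ suc p′)         ≡⟨ proj₂-[2ε]^ (suc p′) ⟩
        (+ 2) ℤ.^ suc p′ * fib (suc p′)     ∎
      p∣expand : + suc p′ ∣ + suc p′ * t ℤ.^ p′ * + 2 + proj₂ e
      p∣expand = ∣m∣n⇒∣m+n (∣m⇒∣m*n (+ 2) (∣m⇒∣m*n (t ℤ.^ p′) ∣-refl)) (proj₂ p∣e)

    [yε]²≡ : ∀ y → (0ℤ , y) · (0ℤ , y) ≡ (y * y , t * (y * y))
    [yε]²≡ y = cong₂ _,_ (solve (y ∷ [])) (solve (t ∷ y ∷ []))

    ∣proj₂⇒p*∣proj₂-^p : ∀ {p D} x y → + p ∣ D → D ∣ y → + p * D ∣ proj₂ ((x , y) ^ p)
    ∣proj₂⇒p*∣proj₂-^p {zero} x y p∣D D∣y = divides 0ℤ refl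
    ∣proj₂⇒p*∣proj₂-^p {suc p′} {D} x y p∣D D∣y
      with binomial-mod x 0ℤ y (subst (+ suc p′ * D ∣ᶜ_) (sym ([yε]²≡ y)) (pD∣y² , ∣n⇒∣m*n t pD∣y²)) p′
      where
      pD∣y² : + suc p′ * D ∣ y * y
      pD∣y² = ∣-trans (*-monoˡ-∣ D p∣D) (*-pres-∣ D∣y D∣y)
    ... | e , pD∣e , eq = subst (+ suc p′ * D ∣_) expand
            (∣m∣n⇒∣m+n (*-pres-∣ {a = + suc p′} (∣m⇒∣m*n (x ℤ.^ p′) ∣-refl) D∣y) (proj₂ pD∣e))
      where
      expand : + suc p′ * x ℤ.^ p′ * y + proj₂ e ≡ proj₂ ((x , y) ^ suc p′)
      expand = trans (cong proj₂ (sym eq)) (cong (λ x → proj₂ ((x , y) ^ suc p′)) (ℤ.+-identityʳ x))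

    ∣fib⇒p*∣fib[p*] : ∀ {p D} k → + p ∣ D → D ∣ fib k → + p * D ∣ fib (p ℕ.* k)
    ∣fib⇒p*∣fib[p*] {p} {D} k p∣D D∣F[k] = subst (+ p * D ∣_) (begin
      proj₂ ((ε ^ k) ^ p)   ≡⟨ cong proj₂ (×-assocˡ ε p k) ⟩
      proj₂ (ε ^ (p ℕ.* k)) ≡⟨ proj₂-ε^ (p ℕ.* k) ⟩
      fib (p ℕ.* k)         ∎)
      (∣proj₂⇒p*∣proj₂-^p {p} (proj₁ (ε ^ k)) (proj₂ (ε ^ k)) p∣D (subst (D ∣_) (sym (proj₂-ε^ k)) D∣F[k]))
      where open ≡-Reasoning

    module _ {p} (p-prime : Prime p) (2<p : 2 ℕ.< p) (p∣disc : + p ∣ t * t + + 4) where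

      p^[1+ν]∣fib[p^[1+ν]*] : ∀ ν m → + (p ℕ.^ suc ν) ∣ fib (p ℕ.^ suc ν ℕ.* m)
      p^[1+ν]∣fib[p^[1+ν]*] zero m =
        subst₂ (λ d n → + d ∣ fib n) (sym (ℕ.*-identityʳ p))
               (trans (ℕ.*-comm m p) (cong (ℕ._* m) (sym (ℕ.*-identityʳ p))))
               (∣fib⇒∣fib-* p (∣disc⇒∣fib p-prime 2<p p∣disc) m)
      p^[1+ν]∣fib[p^[1+ν]*] (suc ν) m =
        subst₂ (λ d n → d ∣ fib n) (sym (ℤ.pos-* p (p ℕ.^ suc ν))) (sym (ℕ.*-assoc p (p ℕ.^ suc ν) m))
               (∣fib⇒p*∣fib[p*] {p} (p ℕ.^ suc ν ℕ.* m) (∣ᵤ⇒∣ (ℕ.m∣m*n (p ℕ.^ ν)))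
                                (p^[1+ν]∣fib[p^[1+ν]*] ν m))

      p^ν∣fib : ∀ ν k → p ℕ.^ ν ℕ.∣ k → + (p ℕ.^ ν) ∣ fib k
      p^ν∣fib zero    k _                  = ∣ᵤ⇒∣ (ℕ.1∣ _)
      p^ν∣fib (suc ν) k (ℕ.divides m refl) =
        subst (λ n → + (p ℕ.^ suc ν) ∣ fib n) (ℕ.*-comm (p ℕ.^ suc ν) m) (p^[1+ν]∣fib[p^[1+ν]*] ν m)

open import Data.Nat using (ℕ; _^_; _%_)
open import Data.Nat.Primality using (Prime)
open import Data.Integer using (ℤ; +_)
open import Data.Integer.Divisibility using (_∣_)
open import Relation.Binary.PropositionalEquality using (_≡_)

import Data.Integer as ℤ
import Data.Integer.Properties as ℤ
import Data.Integer.Divisibility.Signed as Signed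
import Data.Nat as ℕ
import Data.Nat.Properties as ℕ
open import Data.Nat.DivMod using (_/_; m≡m%n+[m/n]*n; m∣n⇒o%n%m≡o%m)
open import Data.Nat.Divisibility using (divides)
open import Relation.Binary.PropositionalEquality using (refl; sym; trans; cong; subst)
open Norm using (fundamental-unit-norm)
open Lucas using (module QuadraticOrder)

lemma16 : (p : ℕ) → Prime p → p % 8 ≡ 5 →
          (t b : ℕ) → IsFundamentalUnit p t b →
          (ν : ℕ) (n : ℤ) → (+ (p ^ ν)) ∣ n → (+ (p ^ ν)) ∣ F t n
lemma16 p p-prime p%8≡5 t b fu ν n p^ν∣n = Signed.∣⇒∣ᵤ (p^ν∣F n p^ν∣n)
  where
  open QuadraticOrder (+ t) using (p^ν∣fib; ∣fib⇒∣fib-neg)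
  p%4≡1 : p % 4 ≡ 1
  p%4≡1 = trans (sym (m∣n⇒o%n%m≡o%m 4 8 p (divides 2 refl))) (cong (_% 4) p%8≡5)
  2<p : 2 ℕ.< p
  2<p = subst (2 ℕ.<_) (sym (trans (m≡m%n+[m/n]*n p 8) (cong (ℕ._+ p / 8 ℕ.* 8) p%8≡5)))
              (ℕ.≤-trans (ℕ.s≤s (ℕ.s≤s (ℕ.s≤s ℕ.z≤n))) (ℕ.m≤m+n 5 _))
  p∣disc : + p Signed.∣ + t ℤ.* + t ℤ.+ + 4
  p∣disc = Signed.divides (+ (b ℕ.* b)) (trans (cong (ℤ._+ + 4) (sym (ℤ.pos-* t t)))
             (trans (cong +_ (fundamental-unit-norm p-prime p%4≡1 fu))
                    (trans (ℤ.pos-* p (b ℕ.* b)) (ℤ.*-comm (+ p) (+ (b ℕ.* b))))))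
  p^ν∣F : ∀ n → + (p ^ ν) ∣ n → + (p ^ ν) Signed.∣ F t n
  p^ν∣F (+ k)      p^ν∣k = p^ν∣fib p-prime 2<p p∣disc ν k p^ν∣k
  p^ν∣F ℤ.-[1+ k ] p^ν∣k = ∣fib⇒∣fib-neg (ℕ.suc k) (p^ν∣fib p-prime 2<p p∣disc ν (ℕ.suc k) p^ν∣k)
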